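{- For every positive even integer $n$ with $n \neq 2$ and $n \neq 6$, the Thue--Morse word $\mathbf{t}$ contains a factor $x$ of length $n$ such that $x$ begins with $1001$ and ends with $1001$, i.e. $x = 1001x'' = x'1001$ for some words $x', x''$.
   Context: Let $\mu$ be the morphism on $\{0,1\}^*$ with $\mu(0)=01$, $\mu(1)=10$. The Thue--Morse word $\mathbf{t} = 011010011001011010010110\cdots$ is the infinite word obtained by iterating $\mu$ on $0$ (the limit of $\mu^k(0)$). A factor is a contiguous finite subword. -}

module Defs where

open import Data.Bool using (Bool; true; false)
open import Data.Nat using (ℕ; zero; suc)
open import Data.List using (List; []; _∷_; _++_; concatMap; [_])
open import Data.Product using (∃; ∃-syntax; _×_)
open import Relation.Binary.PropositionalEquality using (_≡_)

-- Binary letters: false = 0, true = 1.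
Word : Set
Word = List Bool

μ₁ : Bool → Word
μ₁ false = false ∷ true ∷ []
μ₁ true  = true ∷ false ∷ []

μ : Word → Word
μ = concatMap μ₁

μ^ : ℕ → Word
μ^ zero    = false ∷ []
μ^ (suc k) = μ (μ^ k)

IsFactorOf : Word → Word → Set
IsFactorOf x w = ∃[ u ] ∃[ v ] (w ≡ u ++ x ++ v)

-- x is a factor of the Thue–Morse word t = lim μ^k(0):
-- since each μ^k(0) is a prefix of t, and every finite prefix of t is a
-- prefix of some μ^k(0), this is exactly "x occurs in some μ^k(0)".
IsFactorOfTM : Word → Set
IsFactorOfTM x = ∃[ k ] IsFactorOf x (μ^ k)

w1001 : Word
w1001 = true ∷ false ∷ false ∷ true ∷ []

{-# OPTIONS --safe #-}
module Submission where

-- Since μ(10 s 10) = 1001 μ(s) 1001, it suffices to find a factor 10 s 10 with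
-- |s| = k for every k. Every letter b occurs at every distance after every letter a:
-- μ(a r b) = a ā μ(r) b b̄ and μ(a r b̄) = a ā μ(r) b̄ b turn distance |r| into
-- 2|r| + 1 and 2|r| + 2. The same computation shows that if every letter occurs at
-- every distance after u, then also after μ(u). Applying μ to 1 r 1 gives 10 s 10
-- for even k. For odd k, μ(00 r 1) = 0101 μ(r) 10 contains 10 (1 μ(r)) 10, and
-- 00 r 1 occurs inside 1001 r 1, which exists for every |r| since 1001 = μ²(1).

open import Defs
open import Data.Bool using (true; false; not)
open import Data.Bool.Properties using (not-involutive)
open import Data.Nat using (ℕ; zero; suc; _+_; _*_; _<_; _≤_; s≤s)
open import Data.Nat.Induction using (<-rec)
open import Data.Nat.Properties using (+-suc; +-comm; +-identityʳ; m≤m+n; m≤n⇒m≤1+n)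
open import Data.List using ([]; _∷_; length; _++_; [_])
open import Data.List.Properties using (++-assoc; length-++; concatMap-++)
open import Data.Product using (∃-syntax; _×_; _,_)
open import Relation.Binary.PropositionalEquality
  using (_≡_; _≢_; refl; sym; trans; cong; subst; module ≡-Reasoning)

μ-++ : ∀ u v → μ (u ++ v) ≡ μ u ++ μ v
μ-++ = concatMap-++ μ₁

μ-[_] : ∀ a → μ [ a ] ≡ a ∷ not a ∷ []
μ-[ false ] = refl
μ-[ true ]  = refl

length-μ : ∀ w → length (μ w) ≡ length w + length w
length-μ []      = refl
length-μ (a ∷ w) = begin
  length (μ₁ a ++ μ w)          ≡⟨ length-++ (μ₁ a) ⟩
  length (μ₁ a) + length (μ w)  ≡⟨ cong (length (μ₁ a) +_) (length-μ w) ⟩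
  length (μ₁ a) + (n + n)       ≡⟨ cong (_+ (n + n)) (length-μ₁ a) ⟩
  suc (suc (n + n))             ≡⟨ cong suc (+-suc n n) ⟨
  suc n + suc n                 ∎
  where
  open ≡-Reasoning
  n = length w
  length-μ₁ : ∀ a → length (μ₁ a) ≡ 2
  length-μ₁ false = refl
  length-μ₁ true  = refl

IsFactorOf-μ : ∀ {x w} → IsFactorOf x w → IsFactorOf (μ x) (μ w)
IsFactorOf-μ {x} (u , v , refl) = μ u , μ v , (begin
  μ (u ++ x ++ v)      ≡⟨ μ-++ u (x ++ v) ⟩
  μ u ++ μ (x ++ v)    ≡⟨ cong (μ u ++_) (μ-++ x v) ⟩
  μ u ++ μ x ++ μ v    ∎)
  where open ≡-Reasoning

IsFactorOfTM-μ : ∀ {x} → IsFactorOfTM x → IsFactorOfTM (μ x)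
IsFactorOfTM-μ (k , x⊑μᵏ) = suc k , IsFactorOf-μ x⊑μᵏ

IsFactorOfTM-suffix : ∀ u {x} → IsFactorOfTM (u ++ x) → IsFactorOfTM x
IsFactorOfTM-suffix u {x} (k , p , q , eq) =
  k , p ++ u , q , trans eq (trans (cong (p ++_) (++-assoc u x q)) (sym (++-assoc p u (x ++ q))))

IsFactorOfTM-prefix : ∀ {x} v → IsFactorOfTM (x ++ v) → IsFactorOfTM x
IsFactorOfTM-prefix {x} v (k , p , q , eq) =
  k , p , v ++ q , trans eq (cong (p ++_) (++-assoc x v q))

record GapFactor (u : Word) (m : ℕ) (v : Word) : Set where
  constructor gap
  field
    middle        : Word
    length-middle : length middle ≡ m
    occurs        : IsFactorOfTM (u ++ middle ++ v)

GapFactor-dropˡ : ∀ u {u′ m v} → GapFactor (u ++ u′) m v → GapFactor u′ m v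
GapFactor-dropˡ u {u′} {v = v} (gap r ∣r∣ h) =
  gap r ∣r∣ (IsFactorOfTM-suffix u (subst IsFactorOfTM (++-assoc u u′ (r ++ v)) h))

GapFactor-dropʳ : ∀ {u m} v v′ → GapFactor u m (v ++ v′) → GapFactor u m v
GapFactor-dropʳ {u} v v′ (gap r ∣r∣ h) =
  gap r ∣r∣ (IsFactorOfTM-prefix v′ (subst IsFactorOfTM eq h))
  where
  open ≡-Reasoning
  eq : u ++ r ++ v ++ v′ ≡ (u ++ r ++ v) ++ v′
  eq = begin
    u ++ r ++ v ++ v′       ≡⟨ cong (u ++_) (++-assoc r v v′) ⟨
    u ++ (r ++ v) ++ v′     ≡⟨ ++-assoc u (r ++ v) v′ ⟨
    (u ++ r ++ v) ++ v′     ∎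

GapFactor-absorbˡ : ∀ u {c m v} → GapFactor (u ++ [ c ]) m v → GapFactor u (suc m) v
GapFactor-absorbˡ u {c} {v = v} (gap r ∣r∣ h) =
  gap (c ∷ r) (cong suc ∣r∣) (subst IsFactorOfTM (++-assoc u [ c ] (r ++ v)) h)

GapFactor-absorbʳ : ∀ {u m} c v → GapFactor u m (c ∷ v) → GapFactor u (suc m) v
GapFactor-absorbʳ {u} c v (gap r ∣r∣ h) =
  gap (r ++ [ c ])
      (trans (length-++ r) (trans (+-comm (length r) 1) (cong suc ∣r∣)))
      (subst IsFactorOfTM (sym (cong (u ++_) (++-assoc r [ c ] v))) h)

GapFactor-μ : ∀ {u j v} → GapFactor u j v → GapFactor (μ u) (j + j) (μ v)
GapFactor-μ {u} {j} {v} (gap r refl h) =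
  gap (μ r) (length-μ r) (subst IsFactorOfTM eq (IsFactorOfTM-μ h))
  where
  open ≡-Reasoning
  eq : μ (u ++ r ++ v) ≡ μ u ++ μ r ++ μ v
  eq = begin
    μ (u ++ r ++ v)      ≡⟨ μ-++ u (r ++ v) ⟩
    μ u ++ μ (r ++ v)    ≡⟨ cong (μ u ++_) (μ-++ r v) ⟩
    μ u ++ μ r ++ μ v    ∎

GapFactor-μ-even : ∀ {u j} b → GapFactor u j [ b ] → GapFactor (μ u) (j + j) [ b ]
GapFactor-μ-even {u} {j} b g =
  GapFactor-dropʳ [ b ] [ not b ] (subst (GapFactor (μ u) (j + j)) (μ-[ b ]) (GapFactor-μ g))

GapFactor-μ-odd : ∀ {u j} b → GapFactor u j [ not b ] → GapFactor (μ u) (suc (j + j)) [ b ]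
GapFactor-μ-odd {u} {j} b g =
  subst (λ c → GapFactor (μ u) (suc (j + j)) [ c ]) (not-involutive b)
    (GapFactor-absorbʳ (not b) [ not (not b) ]
      (subst (GapFactor (μ u) (j + j)) (μ-[ not b ]) (GapFactor-μ g)))

data ParityView : ℕ → Set where
  even : ∀ j → ParityView (j + j)
  odd  : ∀ j → ParityView (suc (j + j))

parityView : ∀ n → ParityView n
parityView zero = even 0
parityView (suc n) with parityView n
... | even j = odd j
... | odd j  = subst ParityView (cong suc (+-suc j j)) (even (suc j))

GapFactor-μ-upTo : ∀ {u} k → (∀ {j} → j ≤ k → ∀ c → GapFactor u j [ c ]) →
                   ∀ b → GapFactor (μ u) k [ b ]
GapFactor-μ-upTo k gaps b with parityView k
... | even j = GapFactor-μ-even b (gaps (m≤m+n j j) b)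
... | odd j  = GapFactor-μ-odd b (gaps (m≤n⇒m≤1+n (m≤m+n j j)) (not b))

AllGapsAfter : Word → Set
AllGapsAfter u = ∀ m b → GapFactor u m [ b ]

AllGapsAfter-μ : ∀ {u} → AllGapsAfter u → AllGapsAfter (μ u)
AllGapsAfter-μ gaps k = GapFactor-μ-upTo k (λ {j} _ → gaps j)

adjacent : ∀ a b → IsFactorOfTM (a ∷ b ∷ [])
adjacent false false = 3 , false ∷ true ∷ true ∷ false ∷ true ∷ [] , [ true ] , refl
adjacent false true  = 3 , [] , true ∷ false ∷ true ∷ false ∷ false ∷ true ∷ [] , refl
adjacent true  false = 3 , false ∷ true ∷ [] , true ∷ false ∷ false ∷ true ∷ [] , refl
adjacent true  true  = 3 , [ false ] , false ∷ true ∷ false ∷ false ∷ true ∷ [] , refl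

AllGapsAfter-letter : ∀ a → AllGapsAfter [ a ]
AllGapsAfter-letter a m = <-rec P step m a
  where
  P : ℕ → Set
  P m = ∀ a b → GapFactor [ a ] m [ b ]
  step : ∀ m → (∀ {j} → j < m → P j) → P m
  step zero    _    a b = gap [] refl (adjacent a b)
  step (suc k) gaps a b = GapFactor-absorbˡ [ a ] (subst (λ u → GapFactor u k [ b ]) (μ-[ a ])
    (GapFactor-μ-upTo k (λ j≤k → gaps (s≤s j≤k) a) b))

GapFactor-00-1 : ∀ m → GapFactor (false ∷ false ∷ []) m [ true ]
GapFactor-00-1 zero    = gap [] refl (3 , false ∷ true ∷ true ∷ false ∷ true ∷ [] , [] , refl)
GapFactor-00-1 (suc k) =
  GapFactor-dropˡ [ true ] (GapFactor-absorbˡ (true ∷ false ∷ false ∷ [])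
    (AllGapsAfter-μ (AllGapsAfter-μ (AllGapsAfter-letter true)) k true))

GapFactor-10-10 : ∀ k → GapFactor (true ∷ false ∷ []) k (true ∷ false ∷ [])
GapFactor-10-10 k with parityView k
... | even j = GapFactor-μ (AllGapsAfter-letter true j true)
... | odd j  = GapFactor-dropˡ [ false ] (GapFactor-absorbˡ (false ∷ true ∷ false ∷ [])
  (GapFactor-μ (GapFactor-00-1 j)))

lemma3 : (n : ℕ) → 0 < n → (∃[ m ] n ≡ 2 * m) → n ≢ 2 → n ≢ 6 →
    ∃[ x ] (IsFactorOfTM x × length x ≡ n
      × (∃[ x″ ] x ≡ w1001 ++ x″) × (∃[ x′ ] x ≡ x′ ++ w1001))
lemma3 .(2 * 0) () (0 , refl) _ _
lemma3 .(2 * 1) _ (1 , refl) n≢2 _ with () ← n≢2 refl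
lemma3 .(2 * 2) _ (2 , refl) _ _ =
  w1001 , (3 , false ∷ true ∷ true ∷ false ∷ [] , [] , refl) , refl ,
  ([] , refl) , ([] , refl)
lemma3 .(2 * 3) _ (3 , refl) _ n≢6 with () ← n≢6 refl
lemma3 .(2 * (4 + k)) _ (suc (suc (suc (suc k))) , refl) _ _ with GapFactor-10-10 k
... | gap s ∣s∣ h =
  μ y , IsFactorOfTM-μ h , length-x , (μ (s ++ true ∷ false ∷ []) , refl) ,
  (w1001 ++ μ s , cong (λ z → true ∷ false ∷ false ∷ true ∷ z) (μ-++ s (true ∷ false ∷ [])))
  where
  y : Word
  y = true ∷ false ∷ s ++ true ∷ false ∷ []
  length-y : length y ≡ 4 + k
  length-y = cong (λ l → suc (suc l))
    (trans (length-++ s) (trans (cong (_+ 2) ∣s∣) (+-comm k 2)))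
  length-x : length (μ y) ≡ 2 * (4 + k)
  length-x = begin
    length (μ y)         ≡⟨ length-μ y ⟩
    length y + length y  ≡⟨ cong (λ l → l + l) length-y ⟩
    (4 + k) + (4 + k)    ≡⟨ cong (4 + k +_) (+-identityʳ (4 + k)) ⟨
    2 * (4 + k)          ∎
    where open ≡-Reasoning
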